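{- Let $n\ge 1$. For every integer $0\le k\le 2^{n-1}$, $$(2k+1)\,\theta(n,k)\ge 2\sum_{i=0}^{k}\theta(n,i).$$
   Context: For $S\subset\{0,1\}^n$, $\theta(n,S)$ is the number of edges of the hypercube $Q_n$ (vertices $\{0,1\}^n$, adjacent iff differing in one coordinate) with exactly one endpoint in $S$; $\theta(n,k)=\min\{\theta(n,S): |S|=k\}$. -}

module Defs where

open import Data.Bool using (Bool; true; false; not; _xor_; if_then_else_)
open import Data.Bool.Properties using () renaming (_≟_ to _≟B_)
open import Data.Nat using (ℕ; zero; suc; _+_; _⊓_; _≡ᵇ_)
open import Data.List using (List; []; _∷_; map; _++_; concatMap; allFin; length)
open import Data.Vec using (Vec; []; _∷_; lookup; _[_]%=_)
import Data.Vec.Properties as VP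
open import Data.Fin using (Fin)
open import Data.Product using (_×_; _,_)
open import Relation.Nullary.Decidable using (⌊_⌋)
import Data.List.Membership.DecPropositional as DecMem

vertices : (n : ℕ) → List (Vec Bool n)
vertices zero    = [] ∷ []
vertices (suc n) = map (false ∷_) (vertices n) ++ map (true ∷_) (vertices n)

sublists : {A : Set} → List A → List (List A)
sublists []       = [] ∷ []
sublists (x ∷ xs) = sublists xs ++ map (x ∷_) (sublists xs)

-- All subsets S ⊆ {0,1}^n, each listed exactly once as a duplicate-free list.
subsets : (n : ℕ) → List (List (Vec Bool n))
subsets n = sublists (vertices n)

mem : {n : ℕ} → Vec Bool n → List (Vec Bool n) → Bool
mem {n} v S = ⌊ DecMem._∈?_ (VP.≡-dec {n = n} _≟B_) v S ⌋

flipAt : {n : ℕ} → Vec Bool n → Fin n → Vec Bool n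
flipAt v i = v [ i ]%= not

-- Edges of Q_n: each edge {v , flipAt v i} listed once, via its endpoint v with v_i = 0.
edges : (n : ℕ) → List (Vec Bool n × Fin n)
edges n = concatMap (λ v → concatMap (λ i → if lookup v i then [] else ((v , i) ∷ [])) (allFin n)) (vertices n)

count : {A : Set} → (A → Bool) → List A → ℕ
count p []       = 0
count p (x ∷ xs) = (if p x then 1 else 0) + count p xs

θS : (n : ℕ) → List (Vec Bool n) → ℕ
θS n S = count (λ { (v , i) → mem v S xor mem (flipAt v i) S }) (edges n)

minWith : ℕ → List ℕ → ℕ
minWith d []       = d
minWith d (x ∷ []) = x
minWith d (x ∷ y ∷ ys) = x ⊓ minWith d (y ∷ ys)

θvals : (n k : ℕ) → List ℕ
θvals n k = concatMap (λ S → if length S ≡ᵇ k then θS n S ∷ [] else []) (subsets n)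

-- θ(n,k) = min { θ(n,S) : |S| = k }  (only meaningful for k ≤ 2^n; default 0 otherwise)
θ : (n k : ℕ) → ℕ
θ n k = minWith 0 (θvals n k)

sumTo : (ℕ → ℕ) → ℕ → ℕ
sumTo f zero    = f 0
sumTo f (suc k) = sumTo f k + f (suc k)

-- Harper's edge-isoperimetric inequality gives θ(n,k) = n k - 2 h(k) for k ≤ 2^n, where
-- h(k) = Σ_{j<k} s(j) and s is the binary digit sum. The lower bound is proved by induction on n,
-- splitting a set along the first coordinate and using h(a) + h(b) + min(a,b) ≤ h(a+b); the upper
-- bound is attained by the initial segments of the binary order. After this substitution the
-- inequality reads 2 Σ_{j<k} (2j+1) s(j) ≤ n k², which follows by induction on n through the parity of k.
module Submission where

open import Data.Bool using (Bool; true; false; _xor_; if_then_else_)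
open import Data.Empty using (⊥; ⊥-elim)
open import Data.Fin using (Fin)
import Data.Fin as Fin
open import Data.List using (List; []; _∷_; map; _++_; concatMap; length; allFin; filterᵇ)
open import Data.List.Membership.Propositional using (_∈_; find; lose)
open import Data.List.Membership.Propositional.Properties
  using (∈-++⁺ˡ; ∈-++⁺ʳ; ∈-++⁻; ∈-map⁺; ∈-map⁻; ∈-filter⁺; ∈-filter⁻; ∈-concatMap⁺; ∈-concatMap⁻)
open import Data.List.Properties using (concatMap-++; concatMap-map; concatMap-cong; map-concatMap; map-tabulate)
open import Data.List.Relation.Unary.All as All using (All; []; _∷_)
open import Data.List.Relation.Unary.Any using (here; there)
open import Data.List.Relation.Unary.Unique.Propositional using (Unique; []; _∷_)
open import Data.List.Relation.Unary.Unique.Propositional.Properties using (++⁺; map⁺)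
open import Data.Nat using (ℕ; zero; suc; _+_; _*_; _^_; _≤_; _<_; _≥_; _⊓_; _≡ᵇ_; _≤?_; z≤n; s≤s; z<s; ⌊_/2⌋; ⌈_/2⌉; _%_)
open import Data.Nat.DivMod using (m*n%n≡0; [m+kn]%n≡m%n)
open import Data.Nat.Induction using (<-wellFounded)
open import Data.Nat.Properties
open import Algebra.Properties.CommutativeSemigroup +-commutativeSemigroup using () renaming (interchange to +-interchange)
open import Data.Nat.Tactic.RingSolver using (solve-∀)
open import Data.Product using (_×_; _,_; ∃-syntax; proj₂)
import Data.Product as Product
open import Data.Sum using (inj₁; inj₂)
open import Data.Unit using (tt)
open import Data.Vec using (Vec; []; _∷_; lookup)
open import Data.Vec.Properties using (∷-injectiveʳ)
open import Function using (_∘_)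
open import Induction.WellFounded using (Acc; acc)
open import Relation.Binary.PropositionalEquality
open import Relation.Nullary using (yes; no)
open import Relation.Nullary.Decidable using (toWitness; fromWitness; T?)
open import Relation.Nullary.Reflects using (Reflects; ofʸ; ofⁿ; fromEquivalence; det)

open import Defs

data ParityView : ℕ → Set where
  even : ∀ x → ParityView (x + x)
  odd  : ∀ x → ParityView (suc (x + x))

parityView : ∀ n → ParityView n
parityView zero = even 0
parityView (suc n) with parityView n
... | even x = odd x
... | odd x  = subst ParityView (cong suc (+-suc x x)) (even (suc x))

double≡*2 : ∀ x → x + x ≡ x * 2
double≡*2 = solve-∀

⌊double/2⌋ : ∀ x → ⌊ x + x /2⌋ ≡ x
⌊double/2⌋ x = sym (n≡⌊n+n/2⌋ x)

⌊double+1/2⌋ : ∀ x → ⌊ suc (x + x) /2⌋ ≡ x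
⌊double+1/2⌋ zero    = refl
⌊double+1/2⌋ (suc x) = cong suc (trans (cong ⌊_/2⌋ (+-suc x x)) (⌊double+1/2⌋ x))

⌈double/2⌉ : ∀ x → ⌈ x + x /2⌉ ≡ x
⌈double/2⌉ x = sym (n≡⌈n+n/2⌉ x)

⌈double+1/2⌉ : ∀ x → ⌈ suc (x + x) /2⌉ ≡ suc x
⌈double+1/2⌉ x = cong suc (⌊double/2⌋ x)

-- Binary digit sum; halving is not structural recursion, so it runs on fuel, and fuel n suffices for n.
popcountWithin : ℕ → ℕ → ℕ
popcountWithin zero    n = 0
popcountWithin (suc f) n = n % 2 + popcountWithin f ⌊ n /2⌋

popcount : ℕ → ℕ
popcount n = popcountWithin n n

popcountWithin-zero : ∀ f → popcountWithin f 0 ≡ 0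
popcountWithin-zero zero    = refl
popcountWithin-zero (suc f) = popcountWithin-zero f

popcountWithin-fuel : ∀ f g {n} → n ≤ f → n ≤ g → popcountWithin f n ≡ popcountWithin g n
popcountWithin-fuel zero    g       z≤n _   = sym (popcountWithin-zero g)
popcountWithin-fuel (suc f) zero    _   z≤n = popcountWithin-zero (suc f)
popcountWithin-fuel (suc f) (suc g) {n} n≤f n≤g =
  cong (n % 2 +_) (popcountWithin-fuel f g (half≤ n≤f) (half≤ n≤g))
  where
  half≤ : ∀ {m} → n ≤ suc m → ⌊ n /2⌋ ≤ m
  half≤ {m} n≤m = ≤-trans (⌊n/2⌋-mono n≤m) (≤-pred (⌊n/2⌋<n m))

popcount-unfold : ∀ n → popcount n ≡ n % 2 + popcount ⌊ n /2⌋
popcount-unfold zero    = refl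
popcount-unfold (suc n) =
  cong (suc n % 2 +_) (popcountWithin-fuel n ⌊ suc n /2⌋ (≤-pred (⌊n/2⌋<n n)) ≤-refl)

popcount-double : ∀ x → popcount (x + x) ≡ popcount x
popcount-double x = begin
  popcount (x + x)                        ≡⟨ popcount-unfold (x + x) ⟩
  (x + x) % 2 + popcount ⌊ x + x /2⌋      ≡⟨ cong₂ (λ r m → r + popcount m) even%2 (⌊double/2⌋ x) ⟩
  popcount x                              ∎
  where
  open ≡-Reasoning
  even%2 : (x + x) % 2 ≡ 0
  even%2 = trans (cong (_% 2) (double≡*2 x)) (m*n%n≡0 x 2)

popcount-double+1 : ∀ x → popcount (suc (x + x)) ≡ suc (popcount x)
popcount-double+1 x = begin
  popcount (suc (x + x))                          ≡⟨ popcount-unfold (suc (x + x)) ⟩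
  suc (x + x) % 2 + popcount ⌊ suc (x + x) /2⌋    ≡⟨ cong₂ (λ r m → r + popcount m) odd%2 (⌊double+1/2⌋ x) ⟩
  suc (popcount x)                                ∎
  where
  open ≡-Reasoning
  odd%2 : suc (x + x) % 2 ≡ 1
  odd%2 = trans (cong (λ m → suc m % 2) (double≡*2 x)) ([m+kn]%n≡m%n 1 x 2)

popcountSum : ℕ → ℕ
popcountSum zero    = 0
popcountSum (suc k) = popcountSum k + popcount k

popcountSum-double : ∀ x → popcountSum (x + x) ≡ popcountSum x + popcountSum x + x
popcountSum-double zero    = refl
popcountSum-double (suc x) = begin
  popcountSum (suc x + suc x)
    ≡⟨ cong (λ m → popcountSum (suc m)) (+-suc x x) ⟩
  popcountSum (x + x) + popcount (x + x) + popcount (suc (x + x))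
    ≡⟨ cong₂ _+_ (cong₂ _+_ (popcountSum-double x) (popcount-double x)) (popcount-double+1 x) ⟩
  popcountSum x + popcountSum x + x + popcount x + suc (popcount x)
    ≡⟨ regroup (popcountSum x) (popcount x) x ⟩
  popcountSum (suc x) + popcountSum (suc x) + suc x
    ∎
  where
  open ≡-Reasoning
  regroup : ∀ a b c → a + a + c + b + suc b ≡ a + b + (a + b) + suc c
  regroup = solve-∀

popcountSum-double+1 : ∀ x → popcountSum (suc (x + x)) ≡ popcountSum x + popcountSum (suc x) + x
popcountSum-double+1 x = begin
  popcountSum (x + x) + popcount (x + x)
    ≡⟨ cong₂ _+_ (popcountSum-double x) (popcount-double x) ⟩
  popcountSum x + popcountSum x + x + popcount x
    ≡⟨ regroup (popcountSum x) (popcount x) x ⟩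
  popcountSum x + popcountSum (suc x) + x
    ∎
  where
  open ≡-Reasoning
  regroup : ∀ a b c → a + a + c + b ≡ a + (a + b) + c
  regroup = solve-∀

popcountSum-halves : ∀ i → popcountSum i ≡ popcountSum ⌈ i /2⌉ + popcountSum ⌊ i /2⌋ + ⌊ i /2⌋
popcountSum-halves i with parityView i
... | even x = trans (popcountSum-double x)
                     (sym (cong₂ (λ c f → popcountSum c + popcountSum f + f) (⌈double/2⌉ x) (⌊double/2⌋ x)))
... | odd x  = trans (popcountSum-double+1 x)
                     (trans (cong (_+ x) (+-comm (popcountSum x) (popcountSum (suc x))))
                            (sym (cong₂ (λ c f → popcountSum c + popcountSum f + f) (⌈double+1/2⌉ x) (⌊double+1/2⌋ x))))

SuperadditiveAt : ℕ → ℕ → Set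
SuperadditiveAt a b = popcountSum a + popcountSum b + a ⊓ b ≤ popcountSum (a + b)

superadditiveAt-sym : ∀ a b → SuperadditiveAt a b → SuperadditiveAt b a
superadditiveAt-sym a b le = begin
  popcountSum b + popcountSum a + b ⊓ a  ≡⟨ cong₂ _+_ (+-comm (popcountSum b) _) (⊓-comm b a) ⟩
  popcountSum a + popcountSum b + a ⊓ b  ≤⟨ le ⟩
  popcountSum (a + b)                    ≡⟨ cong popcountSum (+-comm a b) ⟩
  popcountSum (b + a)                    ∎
  where open ≤-Reasoning

superadditiveAt-zero : ∀ b → SuperadditiveAt 0 b
superadditiveAt-zero b = ≤-reflexive (+-identityʳ (popcountSum b))

⊓-double : ∀ x y → (x + x) ⊓ (y + y) ≡ x ⊓ y + x ⊓ y
⊓-double x y = sym (mono-≤-distrib-⊓ (λ p → +-mono-≤ p p) x y)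

⊓-double-double+1 : ∀ x y → (x + x) ⊓ suc (y + y) ≤ x ⊓ y + x ⊓ suc y
⊓-double-double+1 x y with ≤-<-connex x y
... | inj₁ x≤y = begin
  (x + x) ⊓ suc (y + y)  ≤⟨ m⊓n≤m (x + x) _ ⟩
  x + x                  ≡⟨ sym (cong₂ _+_ (m≤n⇒m⊓n≡m x≤y) (m≤n⇒m⊓n≡m (m≤n⇒m≤1+n x≤y))) ⟩
  x ⊓ y + x ⊓ suc y      ∎
  where open ≤-Reasoning
... | inj₂ y<x = begin
  (x + x) ⊓ suc (y + y)  ≤⟨ m⊓n≤n (x + x) _ ⟩
  suc (y + y)            ≡⟨ sym (+-suc y y) ⟩
  y + suc y              ≡⟨ sym (cong₂ _+_ (m≥n⇒m⊓n≡n (<⇒≤ y<x)) (m≥n⇒m⊓n≡n y<x)) ⟩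
  x ⊓ y + x ⊓ suc y      ∎
  where open ≤-Reasoning

superadditiveAt-double : ∀ x y → SuperadditiveAt x y → SuperadditiveAt (x + x) (y + y)
superadditiveAt-double x y ih = begin
  popcountSum (x + x) + popcountSum (y + y) + (x + x) ⊓ (y + y)
    ≡⟨ cong₂ _+_ (cong₂ _+_ (popcountSum-double x) (popcountSum-double y)) (⊓-double x y) ⟩
  popcountSum x + popcountSum x + x + (popcountSum y + popcountSum y + y) + (x ⊓ y + x ⊓ y)
    ≡⟨ regroup (popcountSum x) (popcountSum y) (x ⊓ y) x y ⟩
  popcountSum x + popcountSum y + x ⊓ y + (popcountSum x + popcountSum y + x ⊓ y) + (x + y)
    ≤⟨ +-monoˡ-≤ (x + y) (+-mono-≤ ih ih) ⟩
  popcountSum (x + y) + popcountSum (x + y) + (x + y)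
    ≡⟨ sym (popcountSum-double (x + y)) ⟩
  popcountSum (x + y + (x + y))
    ≡⟨ cong popcountSum (+-interchange x y x y) ⟩
  popcountSum (x + x + (y + y))
    ∎
  where
  open ≤-Reasoning
  regroup : ∀ a b m x y → a + a + x + (b + b + y) + (m + m) ≡ a + b + m + (a + b + m) + (x + y)
  regroup = solve-∀

superadditiveAt-double-double+1 : ∀ x y → SuperadditiveAt x y → SuperadditiveAt x (suc y) →
                                  SuperadditiveAt (x + x) (suc (y + y))
superadditiveAt-double-double+1 x y ih ih′ = begin
  popcountSum (x + x) + popcountSum (suc (y + y)) + (x + x) ⊓ suc (y + y)
    ≤⟨ +-mono-≤ (≤-reflexive (cong₂ _+_ (popcountSum-double x) (popcountSum-double+1 y))) (⊓-double-double+1 x y) ⟩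
  popcountSum x + popcountSum x + x + (popcountSum y + popcountSum (suc y) + y) + (x ⊓ y + x ⊓ suc y)
    ≡⟨ regroup (popcountSum x) (popcountSum y) (popcountSum (suc y)) (x ⊓ y) (x ⊓ suc y) x y ⟩
  popcountSum x + popcountSum y + x ⊓ y + (popcountSum x + popcountSum (suc y) + x ⊓ suc y) + (x + y)
    ≤⟨ +-monoˡ-≤ (x + y) (+-mono-≤ ih ih′) ⟩
  popcountSum (x + y) + popcountSum (x + suc y) + (x + y)
    ≡⟨ cong (λ m → popcountSum (x + y) + popcountSum m + (x + y)) (+-suc x y) ⟩
  popcountSum (x + y) + popcountSum (suc (x + y)) + (x + y)
    ≡⟨ sym (popcountSum-double+1 (x + y)) ⟩
  popcountSum (suc (x + y + (x + y)))
    ≡⟨ cong popcountSum (interchange x y) ⟩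
  popcountSum (x + x + suc (y + y))
    ∎
  where
  open ≤-Reasoning
  regroup : ∀ a b b′ m m′ x y → a + a + x + (b + b′ + y) + (m + m′) ≡ a + b + m + (a + b′ + m′) + (x + y)
  regroup = solve-∀
  interchange : ∀ x y → suc (x + y + (x + y)) ≡ x + x + suc (y + y)
  interchange = solve-∀

superadditiveAt-double+1 : ∀ x y → SuperadditiveAt x (suc y) → SuperadditiveAt (suc x) y →
                           SuperadditiveAt (suc (x + x)) (suc (y + y))
superadditiveAt-double+1 x y ih ih′ = begin
  popcountSum (suc (x + x)) + popcountSum (suc (y + y)) + suc ((x + x) ⊓ (y + y))
    ≤⟨ +-mono-≤ (≤-reflexive (cong₂ _+_ (popcountSum-double+1 x) (popcountSum-double+1 y))) (s≤s ⊓-bound) ⟩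
  popcountSum x + popcountSum (suc x) + x + (popcountSum y + popcountSum (suc y) + y) + suc (x ⊓ suc y + suc x ⊓ y)
    ≡⟨ regroup (popcountSum x) (popcountSum (suc x)) (popcountSum y) (popcountSum (suc y)) (x ⊓ suc y) (suc x ⊓ y) x y ⟩
  popcountSum x + popcountSum (suc y) + x ⊓ suc y + (popcountSum (suc x) + popcountSum y + suc x ⊓ y) + suc (x + y)
    ≤⟨ +-monoˡ-≤ (suc (x + y)) (+-mono-≤ ih ih′) ⟩
  popcountSum (x + suc y) + popcountSum (suc x + y) + suc (x + y)
    ≡⟨ cong (λ m → popcountSum m + popcountSum (suc (x + y)) + suc (x + y)) (+-suc x y) ⟩
  popcountSum (suc (x + y)) + popcountSum (suc (x + y)) + suc (x + y)
    ≡⟨ sym (popcountSum-double (suc (x + y))) ⟩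
  popcountSum (suc (x + y) + suc (x + y))
    ≡⟨ cong popcountSum (interchange x y) ⟩
  popcountSum (suc (x + x) + suc (y + y))
    ∎
  where
  open ≤-Reasoning
  ⊓-bound : (x + x) ⊓ (y + y) ≤ x ⊓ suc y + suc x ⊓ y
  ⊓-bound = ≤-trans (≤-reflexive (⊓-double x y))
                    (+-mono-≤ (⊓-monoʳ-≤ x (n≤1+n y)) (⊓-monoˡ-≤ y (n≤1+n x)))
  regroup : ∀ a a′ b b′ m m′ x y →
            a + a′ + x + (b + b′ + y) + suc (m + m′) ≡ a + b′ + m + (a′ + b + m′) + suc (x + y)
  regroup = solve-∀
  interchange : ∀ x y → suc (x + y) + suc (x + y) ≡ suc (x + x) + suc (y + y)
  interchange = solve-∀

superadditiveAt-step : ∀ a b → (∀ c d → c + d < a + b → SuperadditiveAt c d) → SuperadditiveAt a b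
superadditiveAt-step a b ih with parityView a | parityView b
... | even zero    | _            = superadditiveAt-zero b
... | _            | even zero    = superadditiveAt-sym 0 a (superadditiveAt-zero a)
... | even (suc x) | even (suc y) =
  superadditiveAt-double (suc x) (suc y)
    (ih (suc x) (suc y) (+-mono-<-≤ (m<m+n (suc x) z<s) (m≤m+n (suc y) (suc y))))
... | even (suc x) | odd y        =
  superadditiveAt-double-double+1 (suc x) y
    (ih (suc x) y (+-mono-<-≤ (m<m+n (suc x) z<s) (m≤n⇒m≤1+n (m≤m+n y y))))
    (ih (suc x) (suc y) (+-mono-<-≤ (m<m+n (suc x) z<s) (s≤s (m≤m+n y y))))
... | odd x        | even (suc y) =
  superadditiveAt-sym (suc y + suc y) (suc (x + x)) (superadditiveAt-double-double+1 (suc y) x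
    (superadditiveAt-sym x (suc y) (ih x (suc y) (+-mono-≤-< (m≤n⇒m≤1+n (m≤m+n x x)) (m<m+n (suc y) z<s))))
    (superadditiveAt-sym (suc x) (suc y) (ih (suc x) (suc y) (+-mono-≤-< (s≤s (m≤m+n x x)) (m<m+n (suc y) z<s)))))
... | odd x        | odd y        =
  superadditiveAt-double+1 x y
    (ih x (suc y) (+-mono-<-≤ (s≤s (m≤m+n x x)) (s≤s (m≤m+n y y))))
    (ih (suc x) y (+-mono-≤-< (s≤s (m≤m+n x x)) (s≤s (m≤m+n y y))))

popcountSum-superadditive : ∀ a b → popcountSum a + popcountSum b + a ⊓ b ≤ popcountSum (a + b)
popcountSum-superadditive a b = go a b (<-wellFounded (a + b))
  where
  go : ∀ a b → Acc _<_ (a + b) → SuperadditiveAt a b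
  go a b (acc rec) = superadditiveAt-step a b (λ c d lt → go c d (rec lt))

indicator : Bool → ℕ
indicator b = if b then 1 else 0

module _ {A : Set} where

  count-++ : ∀ (p : A → Bool) xs ys → count p (xs ++ ys) ≡ count p xs + count p ys
  count-++ p []       ys = refl
  count-++ p (x ∷ xs) ys = trans (cong (indicator (p x) +_) (count-++ p xs ys)) (sym (+-assoc (indicator (p x)) _ _))

  count-cong : ∀ {p q : A → Bool} → (∀ x → p x ≡ q x) → ∀ xs → count p xs ≡ count q xs
  count-cong p≗q []       = refl
  count-cong p≗q (x ∷ xs) = cong₂ (λ b c → indicator b + c) (p≗q x) (count-cong p≗q xs)

  count-≤-+ : ∀ {p q r : A → Bool} → (∀ x → indicator (p x) ≤ indicator (q x) + indicator (r x)) →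
              ∀ xs → count p xs ≤ count q xs + count r xs
  count-≤-+ pointwise []       = ≤-refl
  count-≤-+ {p} {q} {r} pointwise (x ∷ xs) = begin
    indicator (p x) + count p xs
      ≤⟨ +-mono-≤ (pointwise x) (count-≤-+ pointwise xs) ⟩
    indicator (q x) + indicator (r x) + (count q xs + count r xs)
      ≡⟨ +-interchange (indicator (q x)) (indicator (r x)) (count q xs) (count r xs) ⟩
    indicator (q x) + count q xs + (indicator (r x) + count r xs)
      ∎
    where open ≤-Reasoning

  count-+ : ∀ {p q r : A → Bool} → (∀ x → indicator (p x) + indicator (q x) ≡ indicator (r x)) →
            ∀ xs → count p xs + count q xs ≡ count r xs
  count-+ pointwise []       = refl
  count-+ {p} {q} {r} pointwise (x ∷ xs) = begin
    indicator (p x) + count p xs + (indicator (q x) + count q xs)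
      ≡⟨ +-interchange (indicator (p x)) (count p xs) (indicator (q x)) (count q xs) ⟩
    indicator (p x) + indicator (q x) + (count p xs + count q xs)
      ≡⟨ cong₂ _+_ (pointwise x) (count-+ pointwise xs) ⟩
    indicator (r x) + count r xs
      ∎
    where open ≡-Reasoning

module _ {A B : Set} where

  count-map : ∀ (p : B → Bool) (g : A → B) xs → count p (map g xs) ≡ count (p ∘ g) xs
  count-map p g []       = refl
  count-map p g (x ∷ xs) = cong (indicator (p (g x)) +_) (count-map p g xs)

  count-concatMap-∷ : ∀ (p : B → Bool) (e : A → B) (g : A → List B) xs →
                      count p (concatMap (λ x → e x ∷ g x) xs) ≡ count (p ∘ e) xs + count p (concatMap g xs)
  count-concatMap-∷ p e g []       = refl
  count-concatMap-∷ p e g (x ∷ xs) = begin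
    indicator (p (e x)) + count p (g x ++ concatMap (λ x → e x ∷ g x) xs)
      ≡⟨ cong (indicator (p (e x)) +_) (count-++ p (g x) _) ⟩
    indicator (p (e x)) + (count p (g x) + count p (concatMap (λ x → e x ∷ g x) xs))
      ≡⟨ cong (λ c → indicator (p (e x)) + (count p (g x) + c)) (count-concatMap-∷ p e g xs) ⟩
    indicator (p (e x)) + (count p (g x) + (count (p ∘ e) xs + count p (concatMap g xs)))
      ≡⟨ regroup (indicator (p (e x))) (count p (g x)) (count (p ∘ e) xs) _ ⟩
    indicator (p (e x)) + count (p ∘ e) xs + (count p (g x) + count p (concatMap g xs))
      ≡⟨ cong (indicator (p (e x)) + count (p ∘ e) xs +_) (count-++ p (g x) _) ⟨
    indicator (p (e x)) + count (p ∘ e) xs + count p (concatMap g (x ∷ xs))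
      ∎
    where
    open ≡-Reasoning
    regroup : ∀ a b c d → a + (b + (c + d)) ≡ a + c + (b + d)
    regroup = solve-∀

size : (n : ℕ) → (Vec Bool n → Bool) → ℕ
size n f = count f (vertices n)

isCut : ∀ {n} → (Vec Bool n → Bool) → Vec Bool n × Fin n → Bool
isCut f (v , i) = f v xor f (flipAt v i)

boundary : (n : ℕ) → (Vec Bool n → Bool) → ℕ
boundary n f = count (isCut f) (edges n)

θS≡boundary : ∀ n S → θS n S ≡ boundary n (λ v → mem v S)
θS≡boundary n S = count-cong (λ { (v , i) → refl }) (edges n)

upEdge : ∀ {n} → Vec Bool n → Fin n → List (Vec Bool n × Fin n)
upEdge v i = if lookup v i then [] else ((v , i) ∷ [])

upEdges : ∀ {n} → Vec Bool n → List (Vec Bool n × Fin n)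
upEdges {n} v = concatMap (upEdge v) (allFin n)

liftEdge : ∀ {n} → Bool → Vec Bool n × Fin n → Vec Bool (suc n) × Fin (suc n)
liftEdge b = Product.map (b ∷_) Fin.suc

concatMap-upEdge-suc : ∀ {n} b (w : Vec Bool n) is →
  concatMap (upEdge (b ∷ w)) (map Fin.suc is) ≡ map (liftEdge b) (concatMap (upEdge w) is)
concatMap-upEdge-suc b w []       = refl
concatMap-upEdge-suc b w (i ∷ is) with lookup w i
... | true  = concatMap-upEdge-suc b w is
... | false = cong (_ ∷_) (concatMap-upEdge-suc b w is)

upEdges-false : ∀ {n} (w : Vec Bool n) →
  upEdges (false ∷ w) ≡ (false ∷ w , Fin.zero) ∷ map (liftEdge false) (upEdges w)
upEdges-false {n} w = cong ((false ∷ w , Fin.zero) ∷_)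
  (trans (cong (concatMap (upEdge (false ∷ w))) (sym (map-tabulate (λ i → i) Fin.suc)))
         (concatMap-upEdge-suc false w (allFin n)))

upEdges-true : ∀ {n} (w : Vec Bool n) → upEdges (true ∷ w) ≡ map (liftEdge true) (upEdges w)
upEdges-true {n} w = trans (cong (concatMap (upEdge (true ∷ w))) (sym (map-tabulate (λ i → i) Fin.suc)))
                           (concatMap-upEdge-suc true w (allFin n))

size-suc : ∀ n f → size (suc n) f ≡ size n (f ∘ (false ∷_)) + size n (f ∘ (true ∷_))
size-suc n f = trans (count-++ f (map (false ∷_) (vertices n)) _)
                     (cong₂ _+_ (count-map f _ (vertices n)) (count-map f _ (vertices n)))

boundary-suc : ∀ n f → boundary (suc n) f ≡
  size n (λ w → f (false ∷ w) xor f (true ∷ w)) + boundary n (f ∘ (false ∷_)) + boundary n (f ∘ (true ∷_))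
boundary-suc n f = begin
  count (isCut f) (concatMap upEdges (map (false ∷_) V ++ map (true ∷_) V))
    ≡⟨ cong (count (isCut f)) (concatMap-++ upEdges (map (false ∷_) V) _) ⟩
  count (isCut f) (concatMap upEdges (map (false ∷_) V) ++ concatMap upEdges (map (true ∷_) V))
    ≡⟨ count-++ (isCut f) (concatMap upEdges (map (false ∷_) V)) _ ⟩
  count (isCut f) (concatMap upEdges (map (false ∷_) V)) + count (isCut f) (concatMap upEdges (map (true ∷_) V))
    ≡⟨ cong₂ _+_ (cong (count (isCut f)) lower) (cong (count (isCut f)) upper) ⟩
  count (isCut f) (concatMap (λ w → (false ∷ w , Fin.zero) ∷ map (liftEdge false) (upEdges w)) V)
    + count (isCut f) (map (liftEdge true) (edges n))
    ≡⟨ cong₂ _+_ (count-concatMap-∷ (isCut f) _ _ V) (count-map (isCut f) (liftEdge true) (edges n)) ⟩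
  size n (λ w → f (false ∷ w) xor f (true ∷ w))
    + count (isCut f) (concatMap (map (liftEdge false) ∘ upEdges) V) + boundary n (f ∘ (true ∷_))
    ≡⟨ cong (λ c → size n (λ w → f (false ∷ w) xor f (true ∷ w)) + c + boundary n (f ∘ (true ∷_))) lowerCut ⟩
  size n (λ w → f (false ∷ w) xor f (true ∷ w)) + boundary n (f ∘ (false ∷_)) + boundary n (f ∘ (true ∷_))
    ∎
  where
  open ≡-Reasoning
  V : List (Vec Bool n)
  V = vertices n
  lower : concatMap upEdges (map (false ∷_) V) ≡
          concatMap (λ w → (false ∷ w , Fin.zero) ∷ map (liftEdge false) (upEdges w)) V
  lower = trans (concatMap-map upEdges (false ∷_) V) (concatMap-cong upEdges-false V)
  upper : concatMap upEdges (map (true ∷_) V) ≡ map (liftEdge true) (edges n)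
  upper = trans (concatMap-map upEdges (true ∷_) V)
                (trans (concatMap-cong upEdges-true V) (sym (map-concatMap (liftEdge true) upEdges V)))
  lowerCut : count (isCut f) (concatMap (map (liftEdge false) ∘ upEdges) V) ≡ boundary n (f ∘ (false ∷_))
  lowerCut = trans (cong (count (isCut f)) (sym (map-concatMap (liftEdge false) upEdges V)))
                   (count-map (isCut f) (liftEdge false) (edges n))

m+n≤m⊓n+m⊓n+o : ∀ {m n o} → m ≤ n + o → n ≤ m + o → m + n ≤ m ⊓ n + m ⊓ n + o
m+n≤m⊓n+m⊓n+o {m} {n} {o} m≤n+o n≤m+o with ≤-total m n
... | inj₁ m≤n = begin
  m + n              ≤⟨ +-monoʳ-≤ m n≤m+o ⟩
  m + (m + o)        ≡⟨ sym (+-assoc m m o) ⟩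
  m + m + o          ≡⟨ cong (λ k → k + k + o) (sym (m≤n⇒m⊓n≡m m≤n)) ⟩
  m ⊓ n + m ⊓ n + o  ∎
  where open ≤-Reasoning
... | inj₂ n≤m = begin
  m + n              ≤⟨ +-monoˡ-≤ n m≤n+o ⟩
  n + o + n          ≡⟨ +-comm (n + o) n ⟩
  n + (n + o)        ≡⟨ sym (+-assoc n n o) ⟩
  n + n + o          ≡⟨ cong (λ k → k + k + o) (sym (m≥n⇒m⊓n≡n n≤m)) ⟩
  m ⊓ n + m ⊓ n + o  ∎
  where open ≤-Reasoning

indicator-xorˡ : ∀ u v → indicator u ≤ indicator v + indicator (u xor v)
indicator-xorˡ false v     = z≤n
indicator-xorˡ true  false = ≤-refl
indicator-xorˡ true  true  = ≤-refl

indicator-xorʳ : ∀ u v → indicator v ≤ indicator u + indicator (u xor v)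
indicator-xorʳ u     false = z≤n
indicator-xorʳ false true  = ≤-refl
indicator-xorʳ true  true  = ≤-refl

size-boundary-isoperimetric : ∀ n f → n * size n f ≤ boundary n f + 2 * popcountSum (size n f)
size-boundary-isoperimetric zero    f = z≤n
size-boundary-isoperimetric (suc n) f = begin
  suc n * size (suc n) f
    ≡⟨ cong (suc n *_) (size-suc n f) ⟩
  suc n * (a + b)
    ≡⟨ spread n a b ⟩
  n * a + n * b + (a + b)
    ≤⟨ +-mono-≤ (+-mono-≤ (size-boundary-isoperimetric n f₀) (size-boundary-isoperimetric n f₁))
                (m+n≤m⊓n+m⊓n+o a≤b+X b≤a+X) ⟩
  t₀ + 2 * popcountSum a + (t₁ + 2 * popcountSum b) + (a ⊓ b + a ⊓ b + X)
    ≡⟨ regroup t₀ t₁ X (popcountSum a) (popcountSum b) (a ⊓ b) ⟩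
  X + t₀ + t₁ + 2 * (popcountSum a + popcountSum b + a ⊓ b)
    ≤⟨ +-monoʳ-≤ (X + t₀ + t₁) (*-monoʳ-≤ 2 (popcountSum-superadditive a b)) ⟩
  X + t₀ + t₁ + 2 * popcountSum (a + b)
    ≡⟨ sym (cong₂ (λ t s → t + 2 * popcountSum s) (boundary-suc n f) (size-suc n f)) ⟩
  boundary (suc n) f + 2 * popcountSum (size (suc n) f)
    ∎
  where
  open ≤-Reasoning
  f₀ f₁ : Vec Bool n → Bool
  f₀ w = f (false ∷ w)
  f₁ w = f (true ∷ w)
  a b X t₀ t₁ : ℕ
  a = size n f₀
  b = size n f₁
  X = size n (λ w → f₀ w xor f₁ w)
  t₀ = boundary n f₀
  t₁ = boundary n f₁
  a≤b+X : a ≤ b + X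
  a≤b+X = count-≤-+ (λ w → indicator-xorˡ (f₀ w) (f₁ w)) (vertices n)
  b≤a+X : b ≤ a + X
  b≤a+X = count-≤-+ (λ w → indicator-xorʳ (f₀ w) (f₁ w)) (vertices n)
  spread : ∀ n a b → suc n * (a + b) ≡ n * a + n * b + (a + b)
  spread = solve-∀
  regroup : ∀ t₀ t₁ X ha hb m → t₀ + 2 * ha + (t₁ + 2 * hb) + (m + m + X) ≡ X + t₀ + t₁ + 2 * (ha + hb + m)
  regroup = solve-∀

-- The first i vertices in binary order, reading v as a binary number whose first coordinate is
-- the least significant digit.
initialSegment : (n : ℕ) → ℕ → Vec Bool n → Bool
initialSegment zero    zero    []          = false
initialSegment zero    (suc _) []          = true
initialSegment (suc n) i       (false ∷ w) = initialSegment n ⌈ i /2⌉ w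
initialSegment (suc n) i       (true  ∷ w) = initialSegment n ⌊ i /2⌋ w

initialSegment-mono : ∀ n {i j} → j ≤ i → ∀ w → initialSegment n j w ≡ true → initialSegment n i w ≡ true
initialSegment-mono zero    {suc i} {suc j} j≤i []          _  = refl
initialSegment-mono (suc n)             j≤i (false ∷ w) jw = initialSegment-mono n (⌈n/2⌉-mono j≤i) w jw
initialSegment-mono (suc n)             j≤i (true  ∷ w) jw = initialSegment-mono n (⌊n/2⌋-mono j≤i) w jw

⌈/2⌉-≤-half : ∀ n {i} → i ≤ 2 ^ suc n → ⌈ i /2⌉ ≤ 2 ^ n
⌈/2⌉-≤-half n {i} i≤ = begin
  ⌈ i /2⌉               ≤⟨ ⌈n/2⌉-mono (≤-trans i≤ (≤-reflexive (cong (2 ^ n +_) (+-identityʳ (2 ^ n))))) ⟩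
  ⌈ 2 ^ n + 2 ^ n /2⌉   ≡⟨ sym (n≡⌈n+n/2⌉ (2 ^ n)) ⟩
  2 ^ n                 ∎
  where open ≤-Reasoning

⌊/2⌋-≤-half : ∀ n {i} → i ≤ 2 ^ suc n → ⌊ i /2⌋ ≤ 2 ^ n
⌊/2⌋-≤-half n {i} i≤ = ≤-trans (⌊n/2⌋≤⌈n/2⌉ i) (⌈/2⌉-≤-half n i≤)

⌈/2⌉+⌊/2⌋ : ∀ i → ⌈ i /2⌉ + ⌊ i /2⌋ ≡ i
⌈/2⌉+⌊/2⌋ i = trans (+-comm ⌈ i /2⌉ _) (⌊n/2⌋+⌈n/2⌉≡n i)

size-initialSegment : ∀ n i → i ≤ 2 ^ n → size n (initialSegment n i) ≡ i
size-initialSegment zero    zero          _  = refl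
size-initialSegment zero    (suc zero)    _  = refl
size-initialSegment zero    (suc (suc _)) (s≤s ())
size-initialSegment (suc n) i             i≤ = begin
  size (suc n) (initialSegment (suc n) i)
    ≡⟨ size-suc n (initialSegment (suc n) i) ⟩
  size n (initialSegment n ⌈ i /2⌉) + size n (initialSegment n ⌊ i /2⌋)
    ≡⟨ cong₂ _+_ (size-initialSegment n ⌈ i /2⌉ (⌈/2⌉-≤-half n i≤))
                 (size-initialSegment n ⌊ i /2⌋ (⌊/2⌋-≤-half n i≤)) ⟩
  ⌈ i /2⌉ + ⌊ i /2⌋
    ≡⟨ ⌈/2⌉+⌊/2⌋ i ⟩
  i ∎
  where open ≡-Reasoning

indicator-xor-nested : ∀ u v → (v ≡ true → u ≡ true) → indicator (u xor v) + indicator v ≡ indicator u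
indicator-xor-nested false false _   = refl
indicator-xor-nested true  false _   = refl
indicator-xor-nested true  true  _   = refl
indicator-xor-nested false true  v⇒u with v⇒u refl
... | ()

boundary-initialSegment : ∀ n i → i ≤ 2 ^ n → boundary n (initialSegment n i) + 2 * popcountSum i ≤ n * i
boundary-initialSegment zero    zero          _  = z≤n
boundary-initialSegment zero    (suc zero)    _  = z≤n
boundary-initialSegment zero    (suc (suc _)) (s≤s ())
boundary-initialSegment (suc n) i             i≤ = begin
  boundary (suc n) (initialSegment (suc n) i) + 2 * popcountSum i
    ≡⟨ cong₂ (λ t h → t + 2 * h) (boundary-suc n (initialSegment (suc n) i)) (popcountSum-halves i) ⟩
  X + boundary n (seg i⁺) + boundary n (seg i⁻) + 2 * (popcountSum i⁺ + popcountSum i⁻ + i⁻)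
    ≡⟨ regroup X (boundary n (seg i⁺)) (boundary n (seg i⁻)) (popcountSum i⁺) (popcountSum i⁻) i⁻ ⟩
  boundary n (seg i⁺) + 2 * popcountSum i⁺ + (boundary n (seg i⁻) + 2 * popcountSum i⁻) + (X + i⁻ + i⁻)
    ≤⟨ +-monoˡ-≤ (X + i⁻ + i⁻)
         (+-mono-≤ (boundary-initialSegment n i⁺ i⁺≤) (boundary-initialSegment n i⁻ i⁻≤)) ⟩
  n * i⁺ + n * i⁻ + (X + i⁻ + i⁻)
    ≡⟨ cong (λ m → n * i⁺ + n * i⁻ + (m + i⁻)) X+i⁻≡i⁺ ⟩
  n * i⁺ + n * i⁻ + (i⁺ + i⁻)
    ≡⟨ collect n i⁺ i⁻ ⟩
  suc n * (i⁺ + i⁻)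
    ≡⟨ cong (suc n *_) (⌈/2⌉+⌊/2⌋ i) ⟩
  suc n * i
    ∎
  where
  open ≤-Reasoning
  seg : ℕ → Vec Bool n → Bool
  seg = initialSegment n
  i⁺ i⁻ X : ℕ
  i⁺ = ⌈ i /2⌉
  i⁻ = ⌊ i /2⌋
  X = size n (λ w → seg i⁺ w xor seg i⁻ w)
  i⁺≤ : i⁺ ≤ 2 ^ n
  i⁺≤ = ⌈/2⌉-≤-half n i≤
  i⁻≤ : i⁻ ≤ 2 ^ n
  i⁻≤ = ⌊/2⌋-≤-half n i≤
  X+i⁻≡i⁺ : X + i⁻ ≡ i⁺
  X+i⁻≡i⁺ = begin-equality
    X + i⁻                ≡⟨ cong (X +_) (sym (size-initialSegment n i⁻ i⁻≤)) ⟩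
    X + size n (seg i⁻)   ≡⟨ count-+ (λ w → indicator-xor-nested (seg i⁺ w) (seg i⁻ w)
                                        (initialSegment-mono n (⌊n/2⌋≤⌈n/2⌉ i) w)) (vertices n) ⟩
    size n (seg i⁺)       ≡⟨ size-initialSegment n i⁺ i⁺≤ ⟩
    i⁺                    ∎
  regroup : ∀ X t t′ h h′ d → X + t + t′ + 2 * (h + h′ + d) ≡ t + 2 * h + (t′ + 2 * h′) + (X + d + d)
  regroup = solve-∀
  collect : ∀ n a b → n * a + n * b + (a + b) ≡ suc n * (a + b)
  collect = solve-∀

mem-reflects : ∀ {n} (v : Vec Bool n) S → Reflects (v ∈ S) (mem v S)
mem-reflects v S = fromEquivalence toWitness fromWitness

mem-≡ : ∀ {n} {v : Vec Bool n} {S b} → Reflects (v ∈ S) b → mem v S ≡ b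
mem-≡ {v = v} {S} = det (mem-reflects v S)

∈-vertices : ∀ n (v : Vec Bool n) → v ∈ vertices n
∈-vertices zero    []          = here refl
∈-vertices (suc n) (false ∷ w) = ∈-++⁺ˡ (∈-map⁺ (false ∷_) (∈-vertices n w))
∈-vertices (suc n) (true  ∷ w) = ∈-++⁺ʳ (map (false ∷_) (vertices n)) (∈-map⁺ (true ∷_) (∈-vertices n w))

vertices-unique : ∀ n → Unique (vertices n)
vertices-unique zero    = [] ∷ []
vertices-unique (suc n) =
  ++⁺ (map⁺ ∷-injectiveʳ (vertices-unique n)) (map⁺ ∷-injectiveʳ (vertices-unique n)) different-heads
  where
  different-heads : ∀ {v} → v ∈ map (false ∷_) (vertices n) × v ∈ map (true ∷_) (vertices n) → ⊥
  different-heads (v∈F , v∈T) with ∈-map⁻ (false ∷_) v∈F | ∈-map⁻ (true ∷_) v∈T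
  ... | _ , _ , refl | _ , _ , ()

module _ {A : Set} where

  sublists-⊆ : ∀ {xs S : List A} {v} → S ∈ sublists xs → v ∈ S → v ∈ xs
  sublists-⊆ {[]}     (here refl) ()
  sublists-⊆ {x ∷ xs} S∈ v∈S with ∈-++⁻ (sublists xs) S∈
  ... | inj₁ S∈′ = there (sublists-⊆ S∈′ v∈S)
  ... | inj₂ xS∈ with ∈-map⁻ (x ∷_) xS∈
  ...   | S′ , S′∈ , refl with v∈S
  ...     | here v≡x   = here v≡x
  ...     | there v∈S′ = there (sublists-⊆ S′∈ v∈S′)

  filterᵇ-∈-sublists : ∀ (p : A → Bool) xs → filterᵇ p xs ∈ sublists xs
  filterᵇ-∈-sublists p []       = here refl
  filterᵇ-∈-sublists p (x ∷ xs) with p x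
  ... | true  = ∈-++⁺ʳ (sublists xs) (∈-map⁺ (x ∷_) (filterᵇ-∈-sublists p xs))
  ... | false = ∈-++⁺ˡ (filterᵇ-∈-sublists p xs)

  length-filterᵇ : ∀ (p : A → Bool) xs → length (filterᵇ p xs) ≡ count p xs
  length-filterᵇ p []       = refl
  length-filterᵇ p (x ∷ xs) with p x
  ... | true  = cong suc (length-filterᵇ p xs)
  ... | false = length-filterᵇ p xs

  reflects-∈-tail : ∀ {x v : A} {S b} → x ≢ v → Reflects (v ∈ x ∷ S) b → Reflects (v ∈ S) b
  reflects-∈-tail x≢v (ofʸ (here v≡x))  = ⊥-elim (x≢v (sym v≡x))
  reflects-∈-tail x≢v (ofʸ (there v∈S)) = ofʸ v∈S
  reflects-∈-tail x≢v (ofⁿ v∉xS)        = ofⁿ (v∉xS ∘ there)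

  length-sublist : ∀ {xs S : List A} (p : A → Bool) → Unique xs → S ∈ sublists xs →
                   (∀ {v} → v ∈ xs → Reflects (v ∈ S) (p v)) → length S ≡ count p xs
  length-sublist {[]}     p _ (here refl) _ = refl
  length-sublist {x ∷ xs} p (x∉xs ∷ unique) S∈ reflects with ∈-++⁻ (sublists xs) S∈
  ... | inj₁ S∈′ with p x | reflects (here refl)
  ...   | false | _      = length-sublist p unique S∈′ (reflects ∘ there)
  ...   | true  | ofʸ x∈S = ⊥-elim (All.lookup x∉xs (sublists-⊆ S∈′ x∈S) refl)
  length-sublist {x ∷ xs} p (x∉xs ∷ unique) S∈ reflects | inj₂ xS∈ with ∈-map⁻ (x ∷_) xS∈
  ... | S′ , S′∈ , refl with p x | reflects (here refl)
  ...   | true  | _       =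
    cong suc (length-sublist p unique S′∈ (λ v∈ → reflects-∈-tail (All.lookup x∉xs v∈) (reflects (there v∈))))
  ...   | false | ofⁿ x∉S = ⊥-elim (x∉S (here refl))

minWith-≤ : ∀ d {xs : List ℕ} {y} → y ∈ xs → minWith d xs ≤ y
minWith-≤ d {x ∷ []}     (here refl) = ≤-refl
minWith-≤ d {x ∷ z ∷ zs} (here refl) = m⊓n≤m x _
minWith-≤ d {x ∷ z ∷ zs} (there y∈) = ≤-trans (m⊓n≤n x _) (minWith-≤ d y∈)

⊓-∈-∷ : ∀ x {m ms} → m ∈ ms → x ⊓ m ∈ x ∷ ms
⊓-∈-∷ x {m} m∈ with ⊓-sel x m
... | inj₁ x⊓m≡x = here x⊓m≡x
... | inj₂ x⊓m≡m = there (subst (_∈ _) (sym x⊓m≡m) m∈)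

minWith-∈ : ∀ d {xs : List ℕ} {y} → y ∈ xs → minWith d xs ∈ xs
minWith-∈ d {x ∷ []}     _ = here refl
minWith-∈ d {x ∷ z ∷ zs} _ = ⊓-∈-∷ x (minWith-∈ d (here refl))

θS-∈-θvals : ∀ n k {S} → S ∈ subsets n → length S ≡ k → θS n S ∈ θvals n k
θS-∈-θvals n k {S} S∈ refl = ∈-concatMap⁺ _ (lose S∈ θS∈)
  where
  θS∈ : θS n S ∈ (if length S ≡ᵇ length S then θS n S ∷ [] else [])
  θS∈ with length S ≡ᵇ length S | ≡⇒≡ᵇ (length S) (length S) refl
  ... | true | _ = here refl

∈-θvals : ∀ n k {y} → y ∈ θvals n k → ∃[ S ] S ∈ subsets n × length S ≡ k × y ≡ θS n S
∈-θvals n k y∈ with find (∈-concatMap⁻ _ {subsets n} y∈)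
... | S , S∈ , y∈S with length S ≡ᵇ k | ≡ᵇ⇒≡ (length S) k
...   | true  | |S|≡k with y∈S
...     | here y≡θS = S , S∈ , |S|≡k tt , y≡θS

subsetOf : (n : ℕ) → (Vec Bool n → Bool) → List (Vec Bool n)
subsetOf n f = filterᵇ f (vertices n)

mem-subsetOf : ∀ n f v → mem v (subsetOf n f) ≡ f v
mem-subsetOf n f v =
  mem-≡ (fromEquivalence (∈-filter⁺ (T? ∘ f) (∈-vertices n v)) (proj₂ ∘ ∈-filter⁻ (T? ∘ f) {xs = vertices n}))

boundary-cong : ∀ n {f g} → (∀ v → f v ≡ g v) → boundary n f ≡ boundary n g
boundary-cong n f≗g = count-cong (λ { (v , i) → cong₂ _xor_ (f≗g v) (f≗g (flipAt v i)) }) (edges n)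

θS-subsetOf : ∀ n f → θS n (subsetOf n f) ≡ boundary n f
θS-subsetOf n f = trans (θS≡boundary n (subsetOf n f)) (boundary-cong n (mem-subsetOf n f))

size-mem : ∀ n {S} → S ∈ subsets n → size n (λ v → mem v S) ≡ length S
size-mem n {S} S∈ = sym (length-sublist (λ v → mem v S) (vertices-unique n) S∈ (λ {v} _ → mem-reflects v S))

segmentSubset : (n k : ℕ) → List (Vec Bool n)
segmentSubset n k = subsetOf n (initialSegment n k)

θS-segmentSubset-∈-θvals : ∀ n k → k ≤ 2 ^ n → θS n (segmentSubset n k) ∈ θvals n k
θS-segmentSubset-∈-θvals n k k≤ =
  θS-∈-θvals n k (filterᵇ-∈-sublists (initialSegment n k) (vertices n))
                 (trans (length-filterᵇ (initialSegment n k) (vertices n)) (size-initialSegment n k k≤))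

θ-upper : ∀ n k → k ≤ 2 ^ n → θ n k + 2 * popcountSum k ≤ n * k
θ-upper n k k≤ = begin
  θ n k + 2 * popcountSum k
    ≤⟨ +-monoˡ-≤ (2 * popcountSum k) (minWith-≤ 0 (θS-segmentSubset-∈-θvals n k k≤)) ⟩
  θS n (segmentSubset n k) + 2 * popcountSum k
    ≡⟨ cong (_+ 2 * popcountSum k) (θS-subsetOf n (initialSegment n k)) ⟩
  boundary n (initialSegment n k) + 2 * popcountSum k
    ≤⟨ boundary-initialSegment n k k≤ ⟩
  n * k ∎
  where open ≤-Reasoning

θ-lower : ∀ n k → k ≤ 2 ^ n → n * k ≤ θ n k + 2 * popcountSum k
θ-lower n k k≤ with ∈-θvals n k (minWith-∈ 0 (θS-segmentSubset-∈-θvals n k k≤))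
... | S , S∈ , |S|≡k , θ≡θS = begin
  n * k                                         ≡⟨ cong (n *_) |f|≡k ⟨
  n * size n f                                  ≤⟨ size-boundary-isoperimetric n f ⟩
  boundary n f + 2 * popcountSum (size n f)     ≡⟨ cong₂ (λ t s → t + 2 * popcountSum s) θS≡t |f|≡k ⟩
  θ n k + 2 * popcountSum k                     ∎
  where
  open ≤-Reasoning
  f : Vec Bool n → Bool
  f v = mem v S
  |f|≡k : size n f ≡ k
  |f|≡k = trans (size-mem n S∈) |S|≡k
  θS≡t : boundary n f ≡ θ n k
  θS≡t = sym (trans θ≡θS (θS≡boundary n S))

θ-closedForm : ∀ n k → k ≤ 2 ^ n → θ n k + 2 * popcountSum k ≡ n * k
θ-closedForm n k k≤ = ≤-antisym (θ-upper n k k≤) (θ-lower n k k≤)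

weightedPopcountSum : ℕ → ℕ
weightedPopcountSum zero    = 0
weightedPopcountSum (suc k) = weightedPopcountSum k + suc (k + k) * popcount k

popcountSum-by-parts : ∀ k → suc (2 * k) * popcountSum k ≡ weightedPopcountSum k + 2 * sumTo popcountSum k
popcountSum-by-parts zero    = refl
popcountSum-by-parts (suc k) = begin
  suc (2 * suc k) * (h + s)
    ≡⟨ split k h s ⟩
  suc (2 * k) * h + (2 * h + suc (k + k) * s + 2 * s)
    ≡⟨ cong (_+ (2 * h + suc (k + k) * s + 2 * s)) (popcountSum-by-parts k) ⟩
  W + 2 * H + (2 * h + suc (k + k) * s + 2 * s)
    ≡⟨ regroup k h s W H ⟩
  W + suc (k + k) * s + 2 * (H + (h + s))
    ∎
  where
  open ≡-Reasoning
  h s W H : ℕ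
  h = popcountSum k
  s = popcount k
  W = weightedPopcountSum k
  H = sumTo popcountSum k
  split : ∀ k h s → suc (2 * suc k) * (h + s) ≡ suc (2 * k) * h + (2 * h + suc (k + k) * s + 2 * s)
  split = solve-∀
  regroup : ∀ k h s W H → W + 2 * H + (2 * h + suc (k + k) * s + 2 * s) ≡ W + suc (k + k) * s + 2 * (H + (h + s))
  regroup = solve-∀

weightedPopcountSum-double : ∀ x → weightedPopcountSum (x + x) ≡ 4 * weightedPopcountSum x + 2 * (x * x) + x
weightedPopcountSum-double zero    = refl
weightedPopcountSum-double (suc x) = begin
  weightedPopcountSum (suc x + suc x)
    ≡⟨ cong (λ m → weightedPopcountSum (suc m)) (+-suc x x) ⟩
  weightedPopcountSum (x + x) + suc (x + x + (x + x)) * popcount (x + x)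
    + suc (suc (x + x) + suc (x + x)) * popcount (suc (x + x))
    ≡⟨ cong₂ _+_ (cong₂ (λ W σ → W + suc (x + x + (x + x)) * σ) (weightedPopcountSum-double x) (popcount-double x))
                 (cong (suc (suc (x + x) + suc (x + x)) *_) (popcount-double+1 x)) ⟩
  4 * W + 2 * (x * x) + x + suc (x + x + (x + x)) * σ + suc (suc (x + x) + suc (x + x)) * suc σ
    ≡⟨ regroup W σ x ⟩
  4 * (W + suc (x + x) * σ) + 2 * (suc x * suc x) + suc x
    ∎
  where
  open ≡-Reasoning
  W σ : ℕ
  W = weightedPopcountSum x
  σ = popcount x
  regroup : ∀ W σ x → 4 * W + 2 * (x * x) + x + suc (x + x + (x + x)) * σ + suc (suc (x + x) + suc (x + x)) * suc σ
                    ≡ 4 * (W + suc (x + x) * σ) + 2 * (suc x * suc x) + suc x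
  regroup = solve-∀

m<2^m : ∀ m → m < 2 ^ m
m<2^m zero    = z<s
m<2^m (suc m) = begin-strict
  suc m               ≤⟨ m<2^m m ⟩
  2 ^ m               <⟨ m<m+n (2 ^ m) (m^n>0 2 m) ⟩
  2 ^ m + 2 ^ m       ≡⟨ cong (2 ^ m +_) (+-identityʳ (2 ^ m)) ⟨
  2 ^ suc m           ∎
  where open ≤-Reasoning

weightedBound-double : ∀ m x A → 2 * A + x ≤ suc m * (x * x) →
                       2 * (4 * A + 2 * (x * x) + x) + (x + x) ≤ suc (suc m) * ((x + x) * (x + x))
weightedBound-double m x A bound = begin
  2 * (4 * A + 2 * (x * x) + x) + (x + x)   ≡⟨ expand A x ⟩
  4 * (2 * A + x) + 4 * (x * x)             ≤⟨ +-monoˡ-≤ (4 * (x * x)) (*-monoʳ-≤ 4 bound) ⟩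
  4 * (suc m * (x * x)) + 4 * (x * x)       ≡⟨ collect m x ⟩
  suc (suc m) * ((x + x) * (x + x))         ∎
  where
  open ≤-Reasoning
  expand : ∀ A x → 2 * (4 * A + 2 * (x * x) + x) + (x + x) ≡ 4 * (2 * A + x) + 4 * (x * x)
  expand = solve-∀
  collect : ∀ m x → 4 * (suc m * (x * x)) + 4 * (x * x) ≡ suc (suc m) * ((x + x) * (x + x))
  collect = solve-∀

-- Twice the sum of the hypotheses, plus 4x², bounds L + 2σ + 1 by R + m - 4x; conclude with m ≤ 2x.
weightedBound-double+1 : ∀ m x A σ → m ≤ x + x →
  2 * A + x ≤ suc m * (x * x) →
  2 * (A + suc (x + x) * σ) + suc x ≤ suc m * (suc x * suc x) →
  2 * (4 * A + 2 * (x * x) + x + suc (x + x + (x + x)) * σ) + suc (x + x) ≤ suc (suc m) * (suc (x + x) * suc (x + x))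
weightedBound-double+1 m x A σ m≤2x bound bound′ =
  ≤-trans (m≤m+n L (2 * σ + 1)) (+-cancelʳ-≤ (suc m) (L + (2 * σ + 1)) R padded)
  where
  L R : ℕ
  L = 2 * (4 * A + 2 * (x * x) + x + suc (x + x + (x + x)) * σ) + suc (x + x)
  R = suc (suc m) * (suc (x + x) * suc (x + x))
  padded : L + (2 * σ + 1) + suc m ≤ R + suc m
  padded = begin
    L + (2 * σ + 1) + suc m
      ≡⟨ cong (_+ suc m) (expand A x σ) ⟩
    2 * (2 * A + x) + 2 * (2 * (A + suc (x + x) * σ) + suc x) + 4 * (x * x) + suc m
      ≤⟨ +-mono-≤ (+-monoˡ-≤ (4 * (x * x)) (+-mono-≤ (*-monoʳ-≤ 2 bound) (*-monoʳ-≤ 2 bound′)))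
                  (s≤s (≤-trans m≤2x (m≤m+n (x + x) (x + x)))) ⟩
    2 * (suc m * (x * x)) + 2 * (suc m * (suc x * suc x)) + 4 * (x * x) + suc (x + x + (x + x))
      ≡⟨ collect m x ⟩
    R + suc m
      ∎
    where
    open ≤-Reasoning
    expand : ∀ A x σ → 2 * (4 * A + 2 * (x * x) + x + suc (x + x + (x + x)) * σ) + suc (x + x) + (2 * σ + 1)
             ≡ 2 * (2 * A + x) + 2 * (2 * (A + suc (x + x) * σ) + suc x) + 4 * (x * x)
    expand = solve-∀
    collect : ∀ m x → 2 * (suc m * (x * x)) + 2 * (suc m * (suc x * suc x)) + 4 * (x * x) + suc (x + x + (x + x))
              ≡ suc (suc m) * (suc (x + x) * suc (x + x)) + suc m
    collect = solve-∀

weightedPopcountSum-bound : ∀ m k → k ≤ 2 ^ m → 2 * weightedPopcountSum k + k ≤ suc m * (k * k)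
weightedPopcountSum-bound zero    zero          _  = z≤n
weightedPopcountSum-bound zero    (suc zero)    _  = ≤-refl
weightedPopcountSum-bound zero    (suc (suc _)) (s≤s ())
weightedPopcountSum-bound (suc m) k             k≤ with k ≤? 2 ^ m
... | yes k≤′ = ≤-trans (weightedPopcountSum-bound m k k≤′) (*-monoˡ-≤ (k * k) (n≤1+n (suc m)))
... | no  k≰  with parityView k
...   | even x = begin
  2 * weightedPopcountSum (x + x) + (x + x)
    ≡⟨ cong (λ W → 2 * W + (x + x)) (weightedPopcountSum-double x) ⟩
  2 * (4 * weightedPopcountSum x + 2 * (x * x) + x) + (x + x)
    ≤⟨ weightedBound-double m x (weightedPopcountSum x) (weightedPopcountSum-bound m x x≤) ⟩
  suc (suc m) * ((x + x) * (x + x))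
    ∎
  where
  open ≤-Reasoning
  x≤ : x ≤ 2 ^ m
  x≤ = subst (_≤ 2 ^ m) (⌊double/2⌋ x) (⌊/2⌋-≤-half m k≤)
...   | odd x = begin
  2 * (weightedPopcountSum (x + x) + suc (x + x + (x + x)) * popcount (x + x)) + suc (x + x)
    ≡⟨ cong₂ (λ W σ → 2 * (W + suc (x + x + (x + x)) * σ) + suc (x + x))
             (weightedPopcountSum-double x) (popcount-double x) ⟩
  2 * (4 * weightedPopcountSum x + 2 * (x * x) + x + suc (x + x + (x + x)) * popcount x) + suc (x + x)
    ≤⟨ weightedBound-double+1 m x (weightedPopcountSum x) (popcount x) m≤2x
         (weightedPopcountSum-bound m x (≤-trans (n≤1+n x) x+1≤)) (weightedPopcountSum-bound m (suc x) x+1≤) ⟩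
  suc (suc m) * (suc (x + x) * suc (x + x))
    ∎
  where
  open ≤-Reasoning
  x+1≤ : suc x ≤ 2 ^ m
  x+1≤ = subst (_≤ 2 ^ m) (⌈double+1/2⌉ x) (⌈/2⌉-≤-half m k≤)
  m≤2x : m ≤ x + x
  m≤2x = ≤-pred (<-trans (m<2^m m) (≰⇒> k≰))

sumTo-gauss : ∀ n {f g : ℕ → ℕ} k → (∀ i → i ≤ k → f i + 2 * g i ≡ n * i) →
              2 * sumTo f k + 4 * sumTo g k ≡ n * (k * suc k)
sumTo-gauss n {f} {g} zero    closed = begin
  2 * f 0 + 4 * g 0      ≡⟨ double (f 0) (g 0) ⟩
  2 * (f 0 + 2 * g 0)    ≡⟨ cong (2 *_) (closed 0 z≤n) ⟩
  2 * (n * 0)            ≡⟨ cong (2 *_) (*-zeroʳ n) ⟩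
  0                      ≡⟨ *-zeroʳ n ⟨
  n * (0 * 1)            ∎
  where
  open ≡-Reasoning
  double : ∀ a b → 2 * a + 4 * b ≡ 2 * (a + 2 * b)
  double = solve-∀
sumTo-gauss n {f} {g} (suc k) closed = begin
  2 * (sumTo f k + f (suc k)) + 4 * (sumTo g k + g (suc k))
    ≡⟨ regroup (sumTo f k) (f (suc k)) (sumTo g k) (g (suc k)) ⟩
  2 * sumTo f k + 4 * sumTo g k + 2 * (f (suc k) + 2 * g (suc k))
    ≡⟨ cong₂ (λ a b → a + 2 * b) (sumTo-gauss n k (λ i i≤k → closed i (m≤n⇒m≤1+n i≤k))) (closed (suc k) ≤-refl) ⟩
  n * (k * suc k) + 2 * (n * suc k)
    ≡⟨ collect n k ⟩
  n * (suc k * suc (suc k))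
    ∎
  where
  open ≡-Reasoning
  regroup : ∀ F a G b → 2 * (F + a) + 4 * (G + b) ≡ 2 * F + 4 * G + 2 * (a + 2 * b)
  regroup = solve-∀
  collect : ∀ n k → n * (k * suc k) + 2 * (n * suc k) ≡ n * (suc k * suc (suc k))
  collect = solve-∀

average-inequality : ∀ n k (φ h : ℕ → ℕ) W →
  (∀ i → i ≤ k → φ i + 2 * h i ≡ n * i) →
  suc (2 * k) * h k ≡ W + 2 * sumTo h k →
  2 * W ≤ n * (k * k) →
  2 * sumTo φ k ≤ (2 * k + 1) * φ k
average-inequality n k φ h W closed byParts weighted =
  +-cancelʳ-≤ (4 * Σh + n * (k * k)) (2 * Σφ) ((2 * k + 1) * φ k) (begin
    2 * Σφ + (4 * Σh + n * (k * k))             ≡⟨ +-assoc (2 * Σφ) (4 * Σh) _ ⟨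
    2 * Σφ + 4 * Σh + n * (k * k)               ≡⟨ cong (_+ n * (k * k)) (sumTo-gauss n k closed) ⟩
    n * (k * suc k) + n * (k * k)               ≡⟨ factor n k ⟩
    (2 * k + 1) * (n * k)                       ≡⟨ cong ((2 * k + 1) *_) (closed k ≤-refl) ⟨
    (2 * k + 1) * (φ k + 2 * h k)               ≡⟨ distribute k (φ k) (h k) ⟩
    (2 * k + 1) * φ k + 2 * (suc (2 * k) * h k) ≡⟨ cong (λ z → (2 * k + 1) * φ k + 2 * z) byParts ⟩
    (2 * k + 1) * φ k + 2 * (W + 2 * Σh)        ≡⟨ cong ((2 * k + 1) * φ k +_) (double W Σh) ⟩
    (2 * k + 1) * φ k + (2 * W + 4 * Σh)        ≤⟨ +-monoʳ-≤ ((2 * k + 1) * φ k) (+-monoˡ-≤ (4 * Σh) weighted) ⟩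
    (2 * k + 1) * φ k + (n * (k * k) + 4 * Σh)  ≡⟨ cong ((2 * k + 1) * φ k +_) (+-comm (n * (k * k)) (4 * Σh)) ⟩
    (2 * k + 1) * φ k + (4 * Σh + n * (k * k))  ∎)
  where
  Σφ Σh : ℕ
  Σφ = sumTo φ k
  Σh = sumTo h k
  open ≤-Reasoning
  factor : ∀ n k → n * (k * suc k) + n * (k * k) ≡ (2 * k + 1) * (n * k)
  factor = solve-∀
  distribute : ∀ k φ h → (2 * k + 1) * (φ + 2 * h) ≡ (2 * k + 1) * φ + 2 * (suc (2 * k) * h)
  distribute = solve-∀
  double : ∀ W S → 2 * (W + 2 * S) ≡ 2 * W + 4 * S
  double = solve-∀

theorem4p2 : (n : ℕ) → 1 ≤ n → (k : ℕ) → k ≤ 2 ^ (n Data.Nat.∸ 1) →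
    (2 * k + 1) * θ n k ≥ 2 * sumTo (θ n) k
theorem4p2 (suc m) _ k k≤2^m =
  average-inequality (suc m) k (θ (suc m)) popcountSum (weightedPopcountSum k) closed (popcountSum-by-parts k)
    (≤-trans (m≤m+n _ k) (weightedPopcountSum-bound m k k≤2^m))
  where
  closed : ∀ i → i ≤ k → θ (suc m) i + 2 * popcountSum i ≡ suc m * i
  closed i i≤k = θ-closedForm (suc m) i (≤-trans i≤k (≤-trans k≤2^m (m≤m+n (2 ^ m) _)))
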